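{- For each integer $n\geq 3$ there are a finite relational structure $\mathbf{A}_n$ and an $n^2$-ary relation $T_n$ over $A_n$ such that: (i) $\mathrm{size}(\mathbf{A}_n,T_n)=O(n^3\log n)$; (ii) $T_n$ is open-definable in $\mathbf{A}_n$; and (iii) every open formula defining $T_n$ in $\mathbf{A}_n$ has at least $(n-1)^n$ literals.
   Context: Vocabularies are finite and purely relational. Open formulas are quantifier-free first-order formulas with equality (Boolean combinations of atomic formulas $v_i=v_j$ and $R(\bar v)$). For a finite relational structure $\mathbf{A}$ and $T\subseteq A^m$, $T$ is open-definable in $\mathbf{A}$ if some open formula $\varphi(x_1,\dots,x_m)$ in the vocabulary of $\mathbf{A}$ satisfies $T=\{\bar a\in A^m:\mathbf{A}\models\varphi[\bar a]\}$; such $\varphi$ is said to define $T$ in $\mathbf{A}$. Sizes: for a vocabulary $\tau$, $\mathrm{size}(\tau)=(|\tau|+\sum_{R\in\tau}\mathrm{ar}(R))\log|\tau|$; for a $\tau$-structure $\mathbf{A}$, $\mathrm{size}(\mathbf{A})=\mathrm{size}(\tau)+(|A|+\sum_{R\in\tau}\mathrm{ar}(R)|R^{\mathbf{A}}|)\log|A|$; for $T\subseteq A^m$, $\mathrm{size}(\mathbf{A},T)=(\mathrm{size}(\mathbf{A})+m|T|)\log|A|$, where $\log x$ is read as $\max\{\log x,1\}$. -}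

module Defs where

open import Data.Nat using (ℕ; zero; suc; _+_; _*_; _⊔_; _≤_)
open import Data.Nat.Logarithm using (⌈log₂_⌉)
open import Data.Nat.ListAction using (sum)
open import Data.Bool using (Bool; true; false; not; _∧_; _∨_)
open import Data.Fin using (Fin; _≟_)
open import Data.Vec using (Vec; []; _∷_; lookup; map)
open import Data.List using (List; [_]; concatMap; allFin; length; filter)
import Data.List as L
import Data.Bool as B
open import Relation.Nullary.Decidable using (⌊_⌋)
open import Relation.Binary.PropositionalEquality using (_≡_)
open import Data.Product using (Σ)

-- logarithm read as max{⌈log₂ x⌉, 1}; agrees with max{log x,1} up to a constant factor
lg : ℕ → ℕ
lg x = ⌈log₂ x ⌉ ⊔ 1

record Vocabulary : Set where
  field
    nsym : ℕ
    ar   : Fin nsym → ℕ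
open Vocabulary public

tuples : (a m : ℕ) → List (Vec (Fin a) m)
tuples a zero = [ [] ]
tuples a (suc m) = concatMap (λ i → L.map (i ∷_) (tuples a m)) (allFin a)

card : {a m : ℕ} → (Vec (Fin a) m → Bool) → ℕ
card {a} {m} P = length (filter (λ t → P t B.≟ true) (tuples a m))

record Structure (τ : Vocabulary) : Set where
  field
    univ     : ℕ
    nonempty : 1 ≤ univ
    rel      : (R : Fin (nsym τ)) → Vec (Fin univ) (ar τ R) → Bool
open Structure public

sizeVoc : Vocabulary → ℕ
sizeVoc τ = (nsym τ + sum (L.map (ar τ) (allFin (nsym τ)))) * lg (nsym τ)

sizeStr : {τ : Vocabulary} → Structure τ → ℕ
sizeStr {τ} A =
  sizeVoc τ
  + (univ A + sum (L.map (λ R → ar τ R * card (rel A R)) (allFin (nsym τ))))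
    * lg (univ A)

sizeStrRel : {τ : Vocabulary} (A : Structure τ) {m : ℕ} →
             (Vec (Fin (univ A)) m → Bool) → ℕ
sizeStrRel A {m} T = (sizeStr A + m * card T) * lg (univ A)

data Formula (τ : Vocabulary) (m : ℕ) : Set where
  atEq  : Fin m → Fin m → Formula τ m
  atRel : (R : Fin (nsym τ)) → Vec (Fin m) (ar τ R) → Formula τ m
  ¬f   : Formula τ m → Formula τ m
  _∧f_ : Formula τ m → Formula τ m → Formula τ m
  _∨f_ : Formula τ m → Formula τ m → Formula τ m

literals : {τ : Vocabulary} {m : ℕ} → Formula τ m → ℕ
literals (atEq _ _) = 1
literals (atRel _ _) = 1
literals (¬f φ) = literals φ
literals (φ ∧f ψ) = literals φ + literals ψ
literals (φ ∨f ψ) = literals φ + literals ψ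

eval : {τ : Vocabulary} (A : Structure τ) {m : ℕ} →
       Formula τ m → Vec (Fin (univ A)) m → Bool
eval A (atEq i j) t = ⌊ lookup t i ≟ lookup t j ⌋
eval A (atRel R xs) t = rel A R (map (lookup t) xs)
eval A (¬f φ) t = not (eval A φ t)
eval A (φ ∧f ψ) t = eval A φ t ∧ eval A ψ t
eval A (φ ∨f ψ) t = eval A φ t ∨ eval A ψ t

Defines : {τ : Vocabulary} (A : Structure τ) {m : ℕ} →
          Formula τ m → (Vec (Fin (univ A)) m → Bool) → Set
Defines A φ T = ∀ t → eval A φ t ≡ T t

OpenDefinable : {τ : Vocabulary} (A : Structure τ) {m : ℕ} →
                (Vec (Fin (univ A)) m → Bool) → Set
OpenDefinable {τ} A {m} T = Σ (Formula τ m) (λ φ → Defines A φ T)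

module Submission where

-- For n = L + 1 (L = L' + 1) we build a structure with two hubs and, for every
-- row i < n, a short row of L cells and a long row of 2L - 1 cells, related by
-- Succ (next cell of a row), Spoke (hub₀ to short cells, hub₁ to long cells),
-- Row i (cells of row i) and an n-ary Target holding at one tuple only: the
-- cells at position L - 1 of the long rows.  T = {p}, where p puts hub₀ in
-- column 0 of every row i and the short row i in its remaining columns.
--  * Definability: T is defined by the conjunction of the constraints of Shape
--    together with the L ^ n literals ¬ Target(positions f) (shape-standard, φ-true).
--  * Lower bound: sliding the short rows into the long rows yields, for each
--    f : Fin L ^ n, a tuple outside T that agrees with p on all atoms except
--    Target(positions f); by the fooling-pair principle (fooling-pairs) every
--    definition contains all (n - 1) ^ n of these atoms.
--  * Size: every relation has O(n²) tuples and lg N = O(lg n) (size-bound).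

open import Defs
open import Data.Nat as ℕ using (ℕ; zero; suc; _+_; _*_; _^_; _∸_; _≤_; _<_; z≤n; s≤s; ⌊_/2⌋; ⌈_/2⌉)
import Data.Nat.Properties as ℕ
open import Data.Nat.Induction using (<-rec)
open import Data.Nat.Logarithm using (⌈log₂_⌉; ⌈log₂⌉-mono-≤; ⌈log₂2^n⌉≡n; ⌈log₂⌈n/2⌉⌉≡⌈log₂n⌉∸1)
open import Data.Nat.ListAction using (sum)
open import Data.Nat.Tactic.RingSolver using (solve-∀)
open import Data.Fin as Fin using (Fin; zero; suc; toℕ; fromℕ; fromℕ<; inject₁; _↑ˡ_; _↑ʳ_; splitAt; combine; remQuot; cast; _≟_)
open import Data.Fin.Properties using (suc-injective; toℕ-injective; toℕ<n; toℕ-fromℕ; toℕ-fromℕ<; toℕ-↑ˡ; toℕ-inject₁; splitAt-↑ˡ; splitAt-↑ʳ; splitAt⁻¹-↑ˡ; splitAt⁻¹-↑ʳ; remQuot-combine; combine-remQuot; cast-involutive)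
open import Data.Vec as Vec using (Vec; []; _∷_; lookup; tabulate; head)
import Data.Vec.Properties as Vecₚ
open import Data.List as List using (List; []; _∷_; [_]; _++_; length)
open import Data.List.Properties using (length-++; length-map; length-tabulate)
open import Data.List.Membership.Propositional using (_∈_)
open import Data.List.Membership.Propositional.Properties using (∈-∃++; ∈-++⁻; ∈-++⁺ˡ; ∈-++⁺ʳ; ∈-map⁺; ∈-map⁻; ∈-concatMap⁺; ∈-concatMap⁻; ∈-allFin; ∈-filter⁻)
open import Data.List.Relation.Unary.Any as Any using (here; there)
open import Data.List.Relation.Unary.All as All using (All)
import Data.List.Relation.Unary.All.Properties as Allₚ
open import Data.List.Relation.Unary.AllPairs using ([]; _∷_)
open import Data.List.Relation.Unary.Unique.Propositional using (Unique)
import Data.List.Relation.Unary.Unique.Propositional.Properties as Uniqueₚ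
open import Data.Bool as B using (Bool; true; false; not; _∧_; _∨_)
open import Data.Bool.Properties using (∧-conicalˡ; ∧-conicalʳ; ¬-not)
open import Data.Product using (Σ; ∃; _×_; _,_; proj₁; proj₂; uncurry)
open import Data.Sum using (_⊎_; inj₁; inj₂; [_,_]′)
open import Data.Empty using (⊥; ⊥-elim)
open import Function using (_⇔_; mk⇔; Equivalence)
open import Relation.Binary.PropositionalEquality using (_≡_; _≢_; refl; sym; trans; cong; cong₂; subst; subst₂; module ≡-Reasoning)
open import Relation.Nullary using (Dec; yes; no; ¬_)
open import Relation.Nullary.Decidable using (⌊_⌋)

vec-ext : ∀ {A : Set} {k} {u v : Vec A k} → (∀ i → lookup u i ≡ lookup v i) → u ≡ v
vec-ext {u = u} {v} same = trans (sym (Vecₚ.tabulate∘lookup u)) (trans (Vecₚ.tabulate-cong same) (Vecₚ.tabulate∘lookup v))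

⌊⌋-witness : ∀ {P : Set} (d : Dec P) → ⌊ d ⌋ ≡ true → P
⌊⌋-witness (yes p) _ = p

⌊⌋-true : ∀ {P : Set} (d : Dec P) → P → ⌊ d ⌋ ≡ true
⌊⌋-true (yes _) _ = refl
⌊⌋-true (no ¬p) p = ⊥-elim (¬p p)

⌊⌋-false : ∀ {P : Set} (d : Dec P) → ¬ P → ⌊ d ⌋ ≡ false
⌊⌋-false (yes p) ¬p = ⊥-elim (¬p p)
⌊⌋-false (no _) _ = refl

⌊⌋-⇔ : ∀ {P Q : Set} (d : Dec P) (e : Dec Q) → (P → Q) → (Q → P) → ⌊ d ⌋ ≡ ⌊ e ⌋
⌊⌋-⇔ (yes p) e to _ = sym (⌊⌋-true e (to p))
⌊⌋-⇔ (no ¬p) e _ from = sym (⌊⌋-false e (λ q → ¬p (from q)))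

isTuple : ∀ {a k} → Vec (Fin a) k → Vec (Fin a) k → Bool
isTuple u v = ⌊ Vecₚ.≡-dec _≟_ v u ⌋

unique⊆⇒length≤ : ∀ {A : Set} {xs ys : List A} → Unique xs → (∀ {x} → x ∈ xs → x ∈ ys) → length xs ≤ length ys
unique⊆⇒length≤ {xs = []} _ _ = z≤n
unique⊆⇒length≤ {xs = x ∷ xs} {ys} (x∉xs ∷ u) xs⊆ys with ∈-∃++ (xs⊆ys (here refl))
... | as , bs , refl = begin
  suc (length xs)                ≤⟨ s≤s (unique⊆⇒length≤ u xs⊆as++bs) ⟩
  suc (length (as ++ bs))        ≡⟨ cong suc (length-++ as) ⟩
  suc (length as + length bs)    ≡⟨ sym (ℕ.+-suc (length as) (length bs)) ⟩
  length as + length (x ∷ bs)    ≡⟨ sym (length-++ as) ⟩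
  length (as ++ x ∷ bs)          ∎
  where
  open ℕ.≤-Reasoning
  xs⊆as++bs : ∀ {y} → y ∈ xs → y ∈ as ++ bs
  xs⊆as++bs {y} y∈xs with ∈-++⁻ as (xs⊆ys (there y∈xs))
  ... | inj₁ y∈as = ∈-++⁺ˡ y∈as
  ... | inj₂ (here refl) = ⊥-elim (All.lookup x∉xs y∈xs refl)
  ... | inj₂ (there y∈bs) = ∈-++⁺ʳ as y∈bs

∈-tuples : ∀ {a m} (t : Vec (Fin a) m) → t ∈ tuples a m
∈-tuples [] = here refl
∈-tuples {a} {suc m} (x ∷ t) =
  ∈-concatMap⁺ (λ i → List.map (i ∷_) (tuples a m))
    (Any.map (λ { refl → ∈-map⁺ (x ∷_) (∈-tuples t) }) (∈-allFin x))

length-tuples : ∀ a m → length (tuples a m) ≡ a ^ m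
length-tuples a zero = refl
length-tuples a (suc m) = trans (length-extend (List.allFin a)) (cong₂ _*_ (length-tabulate {n = a} (λ i → i)) (length-tuples a m))
  where
  length-extend : ∀ is → length (List.concatMap (λ i → List.map (i ∷_) (tuples a m)) is) ≡ length is * length (tuples a m)
  length-extend [] = refl
  length-extend (i ∷ is) = trans (length-++ (List.map (i ∷_) (tuples a m))) (cong₂ _+_ (length-map (i ∷_) (tuples a m)) (length-extend is))

tuples-unique : ∀ a m → Unique (tuples a m)
tuples-unique a zero = All.[] ∷ []
tuples-unique a (suc m) = unique-blocks (List.allFin a) (Uniqueₚ.allFin⁺ a)
  where
  block : Fin a → List (Vec (Fin a) (suc m))
  block i = List.map (i ∷_) (tuples a m)
  head-block : ∀ {i t} → t ∈ block i → i ≡ head t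
  head-block t∈ with ∈-map⁻ _ t∈
  ... | _ , _ , refl = refl
  disjoint : ∀ {i is t} → All.All (i ≢_) is → t ∈ block i → t ∈ List.concatMap block is → ⊥
  disjoint i∉is t∈i t∈is =
    All.lookup i∉is (Any.map (λ t∈j → trans (head-block t∈i) (sym (head-block t∈j))) (∈-concatMap⁻ block t∈is)) refl
  unique-blocks : ∀ is → Unique is → Unique (List.concatMap block is)
  unique-blocks [] _ = []
  unique-blocks (i ∷ is) (i∉is ∷ u) =
    Uniqueₚ.++⁺ (Uniqueₚ.map⁺ Vecₚ.∷-injectiveʳ (tuples-unique a m)) (unique-blocks is u) (λ (t∈i , t∈is) → disjoint i∉is t∈i t∈is)

card≤length : ∀ {a m} (P : Vec (Fin a) m → Bool) (Ls : List (Vec (Fin a) m)) →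
              (∀ t → P t ≡ true → t ∈ Ls) → card P ≤ length Ls
card≤length {a} {m} P Ls P⊆Ls =
  unique⊆⇒length≤ (Uniqueₚ.filter⁺ P? (tuples-unique a m)) (λ {t} t∈ → P⊆Ls t (proj₂ (∈-filter⁻ P? {xs = tuples a m} t∈)))
  where
  P? : ∀ t → Dec (P t ≡ true)
  P? t = P t B.≟ true

card≤image : ∀ {a m k} (P : Vec (Fin a) m → Bool) (g : Fin k → Vec (Fin a) m) →
             (∀ t → P t ≡ true → ∃ λ i → g i ≡ t) → card P ≤ k
card≤image {k = k} P g P⊆img =
  ℕ.≤-trans (card≤length P (List.map g (List.allFin k)) covered) (ℕ.≤-reflexive (trans (length-map g (List.allFin k)) (length-tabulate {n = k} (λ i → i))))
  where
  covered : ∀ t → P t ≡ true → t ∈ List.map g (List.allFin k)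
  covered t Pt with P⊆img t Pt
  ... | i , refl = ∈-map⁺ g (∈-allFin i)

card-isTuple : ∀ {a k} (u : Vec (Fin a) k) → card (isTuple u) ≤ 1
card-isTuple u = card≤image (isTuple u) (λ (_ : Fin 1) → u) (λ t t≡u → zero , sym (⌊⌋-witness (Vecₚ.≡-dec _≟_ t u) t≡u))

sum-tabulate-≤ : ∀ {X : Set} k (g : Fin k → X) (h : X → ℕ) B → (∀ i → h (g i) ≤ B) → sum (List.map h (List.tabulate g)) ≤ k * B
sum-tabulate-≤ zero g h B _ = z≤n
sum-tabulate-≤ (suc k) g h B bounded = ℕ.+-mono-≤ (bounded zero) (sum-tabulate-≤ k (λ i → g (suc i)) h B (λ i → bounded (suc i)))

≤2^⌈log₂⌉ : ∀ n → n ≤ 2 ^ ⌈log₂ n ⌉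
≤2^⌈log₂⌉ = <-rec (λ n → n ≤ 2 ^ ⌈log₂ n ⌉) step
  where
  step : ∀ n → (∀ {m} → m < n → m ≤ 2 ^ ⌈log₂ m ⌉) → n ≤ 2 ^ ⌈log₂ n ⌉
  step zero _ = z≤n
  step (suc zero) _ = s≤s z≤n
  step n@(suc (suc k)) ih = begin
    n                                   ≡⟨ sym (ℕ.⌊n/2⌋+⌈n/2⌉≡n n) ⟩
    ⌊ n /2⌋ + ⌈ n /2⌉                   ≤⟨ ℕ.+-monoˡ-≤ ⌈ n /2⌉ (ℕ.⌊n/2⌋≤⌈n/2⌉ n) ⟩
    ⌈ n /2⌉ + ⌈ n /2⌉                   ≤⟨ ℕ.+-mono-≤ half half ⟩
    2 ^ b + 2 ^ b                       ≡⟨ cong (2 ^ b +_) (sym (ℕ.+-identityʳ (2 ^ b))) ⟩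
    2 ^ suc b                           ≡⟨ cong (2 ^_) ⌈log₂n⌉≡1+b ⟩
    2 ^ ⌈log₂ n ⌉                       ∎
    where
    open ℕ.≤-Reasoning
    b : ℕ
    b = ⌈log₂ ⌈ n /2⌉ ⌉
    half : ⌈ n /2⌉ ≤ 2 ^ b
    half = ih (ℕ.⌈n/2⌉<n k)
    1≤⌈log₂n⌉ : 1 ≤ ⌈log₂ n ⌉
    1≤⌈log₂n⌉ = ⌈log₂⌉-mono-≤ {2} {n} (s≤s (s≤s z≤n))
    ⌈log₂n⌉≡1+b : suc b ≡ ⌈log₂ n ⌉
    ⌈log₂n⌉≡1+b = begin-equality
      suc b                  ≡⟨ cong suc (⌈log₂⌈n/2⌉⌉≡⌈log₂n⌉∸1 n) ⟩
      suc (⌈log₂ n ⌉ ∸ 1)    ≡⟨ ℕ.m+[n∸m]≡n 1≤⌈log₂n⌉ ⟩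
      ⌈log₂ n ⌉              ∎

n≤2^n : ∀ n → n ≤ 2 ^ n
n≤2^n zero = z≤n
n≤2^n (suc n) = ℕ.+-mono-≤ (ℕ.m^n>0 2 n) (ℕ.≤-trans (n≤2^n n) (ℕ.m≤m+n (2 ^ n) 0))

lg-* : ∀ a b → lg (a * b) ≤ lg a + lg b
lg-* a b = ℕ.⊔-lub ⌈log₂⌉-bound (ℕ.≤-trans (ℕ.m≤n⊔m ⌈log₂ a ⌉ 1) (ℕ.m≤m+n (lg a) (lg b)))
  where
  open ℕ.≤-Reasoning
  ⌈log₂⌉-bound : ⌈log₂ (a * b) ⌉ ≤ lg a + lg b
  ⌈log₂⌉-bound = begin
    ⌈log₂ (a * b) ⌉                              ≤⟨ ⌈log₂⌉-mono-≤ (ℕ.*-mono-≤ (≤2^⌈log₂⌉ a) (≤2^⌈log₂⌉ b)) ⟩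
    ⌈log₂ (2 ^ ⌈log₂ a ⌉ * 2 ^ ⌈log₂ b ⌉) ⌉      ≡⟨ cong ⌈log₂_⌉ (sym (ℕ.^-distribˡ-+-* 2 ⌈log₂ a ⌉ ⌈log₂ b ⌉)) ⟩
    ⌈log₂ (2 ^ (⌈log₂ a ⌉ + ⌈log₂ b ⌉)) ⌉        ≡⟨ ⌈log₂2^n⌉≡n (⌈log₂ a ⌉ + ⌈log₂ b ⌉) ⟩
    ⌈log₂ a ⌉ + ⌈log₂ b ⌉                        ≤⟨ ℕ.+-mono-≤ (ℕ.m≤m⊔n ⌈log₂ a ⌉ 1) (ℕ.m≤m⊔n ⌈log₂ b ⌉ 1) ⟩
    lg a + lg b                                  ∎

lg-mono : ∀ {a b} → a ≤ b → lg a ≤ lg b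
lg-mono a≤b = ℕ.⊔-monoˡ-≤ 1 (⌈log₂⌉-mono-≤ a≤b)

1≤lg : ∀ n → 1 ≤ lg n
1≤lg n = ℕ.m≤n⊔m ⌈log₂ n ⌉ 1

lg≤id : ∀ {n} → 1 ≤ n → lg n ≤ n
lg≤id {n} 1≤n = ℕ.⊔-lub (ℕ.≤-trans (⌈log₂⌉-mono-≤ (n≤2^n n)) (ℕ.≤-reflexive (⌈log₂2^n⌉≡n n))) 1≤n

lg-cube : ∀ a → lg (a * (a * a)) ≤ 3 * lg a
lg-cube a = begin
  lg (a * (a * a))           ≤⟨ lg-* a (a * a) ⟩
  lg a + lg (a * a)          ≤⟨ ℕ.+-monoʳ-≤ (lg a) (lg-* a a) ⟩
  lg a + (lg a + lg a)       ≡⟨ cong (λ y → lg a + (lg a + y)) (sym (ℕ.+-identityʳ (lg a))) ⟩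
  3 * lg a                   ∎
  where open ℕ.≤-Reasoning

data Atom (τ : Vocabulary) (m : ℕ) : Set where
  _≐_  : Fin m → Fin m → Atom τ m
  _⟨_⟩ : (R : Fin (nsym τ)) → Vec (Fin m) (ar τ R) → Atom τ m

module _ {τ : Vocabulary} {m : ℕ} where

  atom : Atom τ m → Formula τ m
  atom (i ≐ j) = atEq i j
  atom (R ⟨ xs ⟩) = atRel R xs

  ⟨⟩-injective : ∀ {R} {xs ys : Vec (Fin m) (ar τ R)} → _≡_ {A = Atom τ m} (R ⟨ xs ⟩) (R ⟨ ys ⟩) → xs ≡ ys
  ⟨⟩-injective refl = refl

  atoms : Formula τ m → List (Atom τ m)
  atoms (atEq i j) = [ i ≐ j ]
  atoms (atRel R xs) = [ R ⟨ xs ⟩ ]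
  atoms (¬f φ) = atoms φ
  atoms (φ ∧f ψ) = atoms φ ++ atoms ψ
  atoms (φ ∨f ψ) = atoms φ ++ atoms ψ

  length-atoms : ∀ φ → length (atoms φ) ≡ literals φ
  length-atoms (atEq _ _) = refl
  length-atoms (atRel _ _) = refl
  length-atoms (¬f φ) = length-atoms φ
  length-atoms (φ ∧f ψ) = trans (length-++ (atoms φ)) (cong₂ _+_ (length-atoms φ) (length-atoms ψ))
  length-atoms (φ ∨f ψ) = trans (length-++ (atoms φ)) (cong₂ _+_ (length-atoms φ) (length-atoms ψ))

  module _ (A : Structure τ) where

    Separates : Atom τ m → (p q : Vec (Fin (univ A)) m) → Set
    Separates α p q = eval A (atom α) p ≢ eval A (atom α) q

    separating-atom : ∀ φ {p q} → eval A φ p ≢ eval A φ q → ∃ λ α → α ∈ atoms φ × Separates α p q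

    binary : ∀ φ ψ {p q} → (eval A φ p ≡ eval A φ q → eval A ψ p ≡ eval A ψ q → ⊥) →
             ∃ λ α → α ∈ atoms φ ++ atoms ψ × Separates α p q

    separating-atom (atEq i j) ne = i ≐ j , here refl , ne
    separating-atom (atRel R xs) ne = R ⟨ xs ⟩ , here refl , ne
    separating-atom (¬f φ) ne = separating-atom φ (λ e → ne (cong not e))
    separating-atom (φ ∧f ψ) ne = binary φ ψ (λ e₁ e₂ → ne (cong₂ _∧_ e₁ e₂))
    separating-atom (φ ∨f ψ) ne = binary φ ψ (λ e₁ e₂ → ne (cong₂ _∨_ e₁ e₂))

    binary φ ψ {p} {q} ne with eval A φ p B.≟ eval A φ q
    ... | no neφ with separating-atom φ neφ
    ...   | α , α∈ , sep = α , ∈-++⁺ˡ α∈ , sep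
    binary φ ψ {p} {q} ne | yes eφ with separating-atom ψ (ne eφ)
    ...   | α , α∈ , sep = α , ∈-++⁺ʳ (atoms φ) α∈ , sep

    -- Suppose that for every
    -- index x the tuples p x, q x lie on different sides of T, while w x is the
    -- only atom separating them.  Then any definition of T contains every
    -- atom w x, so for injective w it has at least as many literals as indices.
    fooling-pairs : ∀ {X : Set} (xs : List X) → Unique xs →
      (w : X → Atom τ m) → (∀ {x y} → w x ≡ w y → x ≡ y) →
      (p q : X → Vec (Fin (univ A)) m) (T : Vec (Fin (univ A)) m → Bool) →
      (∀ x → T (p x) ≢ T (q x)) →
      (∀ x α → Separates α (p x) (q x) → α ≡ w x) →
      ∀ φ → Defines A φ T → length xs ≤ literals φ
    fooling-pairs xs unique w w-inj p q T T-splits only-w φ φ-defines =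
      ℕ.≤-trans (ℕ.≤-reflexive (sym (length-map w xs)))
        (ℕ.≤-trans (unique⊆⇒length≤ (Uniqueₚ.map⁺ w-inj unique) w[xs]⊆atoms) (ℕ.≤-reflexive (length-atoms φ)))
      where
      w∈atoms : ∀ x → w x ∈ atoms φ
      w∈atoms x with separating-atom φ (λ e → T-splits x (trans (sym (φ-defines (p x))) (trans e (φ-defines (q x)))))
      ... | α , α∈ , sep rewrite only-w x α sep = α∈
      w[xs]⊆atoms : ∀ {β} → β ∈ List.map w xs → β ∈ atoms φ
      w[xs]⊆atoms β∈ with ∈-map⁻ w β∈
      ... | x , _ , refl = w∈atoms x

⋀ : ∀ {τ m} → Fin m → List (Formula τ m) → Formula τ m
⋀ x₀ [] = atEq x₀ x₀
⋀ x₀ (φ ∷ φs) = φ ∧f ⋀ x₀ φs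

⋀-true : ∀ {τ m} (A : Structure τ) (x₀ : Fin m) φs {t} →
         eval A (⋀ x₀ φs) t ≡ true ⇔ All (λ φ → eval A φ t ≡ true) φs
⋀-true A x₀ [] {t} = mk⇔ (λ _ → All.[]) (λ _ → ⌊⌋-true (lookup t x₀ ≟ lookup t x₀) refl)
⋀-true A x₀ (φ ∷ φs) {t} = mk⇔
  (λ h → ∧-conicalˡ _ _ h All.∷ Equivalence.to (⋀-true A x₀ φs) (∧-conicalʳ _ _ h))
  (λ { (h All.∷ hs) → cong₂ _∧_ h (Equivalence.from (⋀-true A x₀ φs) hs) })

⋀-tabulate : ∀ {τ m} (A : Structure τ) (x₀ : Fin m) {k} (g : Fin k → Formula τ m) {t} →
             eval A (⋀ x₀ (List.tabulate g)) t ≡ true ⇔ (∀ i → eval A (g i) t ≡ true)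
⋀-tabulate A x₀ g = mk⇔ (λ h → Allₚ.tabulate⁻ (Equivalence.to (⋀-true A x₀ (List.tabulate g)) h))
                        (λ h → Equivalence.from (⋀-true A x₀ (List.tabulate g)) (Allₚ.tabulate⁺ h))

⋀-map : ∀ {τ m} (A : Structure τ) (x₀ : Fin m) {X : Set} (g : X → Formula τ m) xs {t} →
        eval A (⋀ x₀ (List.map g xs)) t ≡ true ⇔ All (λ x → eval A (g x) t ≡ true) xs
⋀-map A x₀ g xs = mk⇔ (λ h → Allₚ.map⁻ (Equivalence.to (⋀-true A x₀ (List.map g xs)) h))
                      (λ h → Equivalence.from (⋀-true A x₀ (List.map g xs)) (Allₚ.map⁺ h))

step-back : ∀ {n K} {i i' : Fin n} {k k' : Fin K} → ⌊ i ≟ i' ⌋ ∧ ⌊ suc (toℕ k) ℕ.≟ toℕ k' ⌋ ≡ true → i ≡ i' × k ≡ Fin.pred k'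
step-back {i = i} {i'} {k} {zero} s with ∧-conicalʳ ⌊ i ≟ i' ⌋ _ s
... | ()
step-back {i = i} {i'} {k} {suc j} s =
  ⌊⌋-witness (i ≟ i') (∧-conicalˡ _ _ s) ,
  toℕ-injective (trans (ℕ.suc-injective (⌊⌋-witness (suc (toℕ k) ℕ.≟ toℕ (suc j)) (∧-conicalʳ _ _ s))) (sym (toℕ-inject₁ j)))

progression : ∀ {K} (a : Fin (suc K) → ℕ) → (∀ (k : Fin K) → a (suc k) ≡ suc (a (inject₁ k))) →
              ∀ k → a k ≡ a zero + toℕ k
progression a step zero = sym (ℕ.+-identityʳ _)
progression {suc K} a step (suc k) = begin
  a (suc k)                       ≡⟨ step k ⟩
  suc (a (inject₁ k))             ≡⟨ cong suc (progression (λ j → a (inject₁ j)) (λ j → step (inject₁ j)) k) ⟩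
  suc (a zero + toℕ k)            ≡⟨ sym (ℕ.+-suc (a zero) (toℕ k)) ⟩
  a zero + suc (toℕ k)            ∎
  where
  open ≡-Reasoning

module Construction (L' : ℕ) where

  L M W n N m : ℕ
  L = suc L'
  M = L + L'
  W = L + M
  n = suc L
  N = 2 + n * W
  m = n ^ 2

  data Elem : Set where
    hub₀ hub₁ : Elem
    short : Fin n → Fin L → Elem
    long  : Fin n → Fin M → Elem

  -- Coding of the universe: Fin N = two hubs, then n rows of W = L + M cells.
  cell : Fin n → Fin W → Elem
  cell i j = [ short i , long i ]′ (splitAt L j)

  dec : Fin N → Elem
  dec zero = hub₀
  dec (suc zero) = hub₁
  dec (suc (suc x)) = uncurry cell (remQuot W x)

  enc : Elem → Fin N
  enc hub₀ = zero
  enc hub₁ = suc zero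
  enc (short i k) = suc (suc (combine i (k ↑ˡ M)))
  enc (long i k) = suc (suc (combine i (L ↑ʳ k)))

  dec-enc : ∀ e → dec (enc e) ≡ e
  dec-enc hub₀ = refl
  dec-enc hub₁ = refl
  dec-enc (short i k) = trans (cong (uncurry cell) (remQuot-combine i (k ↑ˡ M))) (cong [ short i , long i ]′ (splitAt-↑ˡ L k M))
  dec-enc (long i k) = trans (cong (uncurry cell) (remQuot-combine i (L ↑ʳ k))) (cong [ short i , long i ]′ (splitAt-↑ʳ L M k))

  enc-dec : ∀ x → enc (dec x) ≡ x
  enc-dec zero = refl
  enc-dec (suc zero) = refl
  enc-dec (suc (suc x)) = trans (enc-cell (remQuot {n} W x)) (cong (λ y → suc (suc y)) (combine-remQuot {n} W x))
    where
    enc-cell : ∀ ij → enc (uncurry cell ij) ≡ suc (suc (uncurry combine ij))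
    enc-cell (i , j) with splitAt L j in eq
    ... | inj₁ k = cong (λ y → suc (suc (combine i y))) (splitAt⁻¹-↑ˡ eq)
    ... | inj₂ k = cong (λ y → suc (suc (combine i y))) (splitAt⁻¹-↑ʳ eq)

  Succ : Elem → Elem → Bool
  Succ (short i k) (short i' k') = ⌊ i ≟ i' ⌋ ∧ ⌊ suc (toℕ k) ℕ.≟ toℕ k' ⌋
  Succ (long i k) (long i' k') = ⌊ i ≟ i' ⌋ ∧ ⌊ suc (toℕ k) ℕ.≟ toℕ k' ⌋
  Succ _ _ = false

  Spoke : Elem → Elem → Bool
  Spoke hub₀ (short _ _) = true
  Spoke hub₁ (long _ _) = true
  Spoke _ _ = false

  Row : Fin n → Elem → Bool
  Row i (short i' _) = ⌊ i ≟ i' ⌋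
  Row i (long i' _) = ⌊ i ≟ i' ⌋
  Row _ _ = false

  far : Fin M
  far = fromℕ L' ↑ˡ L'

  toℕ-far : toℕ far ≡ L'
  toℕ-far = trans (toℕ-↑ˡ (fromℕ L') L') (toℕ-fromℕ L')

  target : Vec (Fin N) n
  target = tabulate (λ i → enc (long i far))

  arity : Fin (3 + n) → ℕ
  arity zero = 2
  arity (suc zero) = 2
  arity (suc (suc zero)) = n
  arity (suc (suc (suc _))) = 1

  τ : Vocabulary
  τ = record { nsym = 3 + n ; ar = arity }

  succᴿ spokeᴿ targetᴿ : Fin (3 + n)
  succᴿ = zero
  spokeᴿ = suc zero
  targetᴿ = suc (suc zero)
  rowᴿ : Fin n → Fin (3 + n)
  rowᴿ i = suc (suc (suc i))

  interpret : (R : Fin (3 + n)) → Vec (Fin N) (arity R) → Bool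
  interpret zero (a ∷ b ∷ []) = Succ (dec a) (dec b)
  interpret (suc zero) (a ∷ b ∷ []) = Spoke (dec a) (dec b)
  interpret (suc (suc zero)) v = isTuple target v
  interpret (suc (suc (suc i))) (a ∷ []) = Row i (dec a)

  A : Structure τ
  A = record { univ = N ; nonempty = s≤s z≤n ; rel = interpret }

  -- Variables are indexed by pairs (row i, column j), column 0 being the hub column.
  n*n≡m : n * n ≡ m
  n*n≡m = cong (n *_) (sym (ℕ.*-identityʳ n))

  var : Fin n → Fin n → Fin m
  var i j = cast n*n≡m (combine i j)

  unvar : Fin m → Fin n × Fin n
  unvar x = remQuot n (cast (sym n*n≡m) x)

  unvar-var : ∀ i j → unvar (var i j) ≡ (i , j)
  unvar-var i j = trans (cong (remQuot n) (cast-involutive (sym n*n≡m) n*n≡m (combine i j))) (remQuot-combine i j)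

  var-unvar : ∀ x → uncurry var (unvar x) ≡ x
  var-unvar x = trans (cong (cast n*n≡m) (combine-remQuot {n} n (cast (sym n*n≡m) x))) (cast-involutive n*n≡m (sym n*n≡m) x)

  Assignment : Set
  Assignment = Fin n → Fin n → Elem

  ⟦_⟧ : Assignment → Vec (Fin N) m
  ⟦ ρ ⟧ = tabulate (λ x → enc (uncurry ρ (unvar x)))

  read : Vec (Fin N) m → Assignment
  read t i j = dec (lookup t (var i j))

  dec-⟦⟧ : ∀ ρ x → dec (lookup ⟦ ρ ⟧ x) ≡ uncurry ρ (unvar x)
  dec-⟦⟧ ρ x = trans (cong dec (Vecₚ.lookup∘tabulate (λ y → enc (uncurry ρ (unvar y))) x)) (dec-enc _)

  read-⟦⟧ : ∀ ρ i j → read ⟦ ρ ⟧ i j ≡ ρ i j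
  read-⟦⟧ ρ i j = trans (dec-⟦⟧ ρ (var i j)) (cong (uncurry ρ) (unvar-var i j))

  ⟦read⟧ : ∀ t → ⟦ read t ⟧ ≡ t
  ⟦read⟧ t = vec-ext λ x → begin
    lookup ⟦ read t ⟧ x                      ≡⟨ Vecₚ.lookup∘tabulate (λ y → enc (uncurry (read t) (unvar y))) x ⟩
    enc (dec (lookup t (uncurry var (unvar x)))) ≡⟨ enc-dec _ ⟩
    lookup t (uncurry var (unvar x))         ≡⟨ cong (lookup t) (var-unvar x) ⟩
    lookup t x                               ∎
    where open ≡-Reasoning

  standard : Assignment
  standard i zero = hub₀
  standard i (suc k) = short i k

  p : Vec (Fin N) m
  p = ⟦ standard ⟧

  T : Vec (Fin N) m → Bool
  T = isTuple p

  position : Elem → ℕ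
  position (short _ k) = toℕ k
  position (long _ k) = toℕ k
  position _ = 0

  succ-position : ∀ {a b} → Succ a b ≡ true → position b ≡ suc (position a)
  succ-position {short i k} {short i' k'} s = sym (⌊⌋-witness (suc (toℕ k) ℕ.≟ toℕ k') (∧-conicalʳ _ _ s))
  succ-position {long i k} {long i' k'} s = sym (⌊⌋-witness (suc (toℕ k) ℕ.≟ toℕ k') (∧-conicalʳ _ _ s))

  spoke-source : ∀ {h e} → Spoke h e ≡ true → (h ≡ hub₀) ⊎ (h ≡ hub₁)
  spoke-source {hub₀} {short _ _} _ = inj₁ refl
  spoke-source {hub₁} {long _ _} _ = inj₂ refl

  short-bound : ∀ {e} → Spoke hub₀ e ≡ true → position e < L
  short-bound {short _ k} _ = toℕ<n k

  short-at : ∀ {i e} k → Spoke hub₀ e ≡ true → Row i e ≡ true → position e ≡ toℕ k → e ≡ short i k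
  short-at {i} {short i' k'} k _ row pos = cong₂ short (sym (⌊⌋-witness (i ≟ i') row)) (toℕ-injective pos)

  long-bound : ∀ {e} → Spoke hub₁ e ≡ true → position e < M
  long-bound {long _ k} _ = toℕ<n k

  long-at : ∀ {i e} k → Spoke hub₁ e ≡ true → Row i e ≡ true → position e ≡ toℕ k → e ≡ long i k
  long-at {i} {long i' k'} k _ row pos = cong₂ long (sym (⌊⌋-witness (i ≟ i') row)) (toℕ-injective pos)

  -- What the defining formula says about an assignment ρ (column 0 is the hub column).
  record Shape (ρ : Assignment) : Set where
    field
      hubs   : ∀ i → ρ i zero ≡ ρ zero zero
      rows   : ∀ i (k : Fin L) → Row i (ρ i (suc k)) ≡ true
      steps  : ∀ i (k : Fin L') → Succ (ρ i (suc (inject₁ k))) (ρ i (suc (suc k))) ≡ true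
      spokes : ∀ i (k : Fin L) → Spoke (ρ zero zero) (ρ i (suc k)) ≡ true
      misses : ∀ (f : Vec (Fin L) n) → ¬ (∀ i → ρ i (suc (lookup f i)) ≡ long i far)

  -- Each row is a Succ-chain of L cells.  Under hub₀ the chain lies in a short
  -- row of length L, so it fills it exactly.  Under hub₁ it lies in a long row
  -- and passes through the cell far, so some choice f hits the target.
  module _ {ρ : Assignment} (shape : Shape ρ) where
    open Shape shape

    private
      pos : Fin n → Fin L → ℕ
      pos i k = position (ρ i (suc k))

      pos-progression : ∀ i k → pos i k ≡ pos i zero + toℕ k
      pos-progression i = progression (pos i) (λ k → succ-position {ρ i (suc (inject₁ k))} (steps i k))

      pos-end : ∀ i → pos i (fromℕ L') ≡ pos i zero + L'
      pos-end i = trans (pos-progression i (fromℕ L')) (cong (pos i zero +_) (toℕ-fromℕ L'))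

      spokes-from : ∀ {h} → ρ zero zero ≡ h → ∀ i k → Spoke h (ρ i (suc k)) ≡ true
      spokes-from eq i k = subst (λ h → Spoke h (ρ i (suc k)) ≡ true) eq (spokes i k)

      standard-under-hub₀ : ρ zero zero ≡ hub₀ → ∀ i j → ρ i j ≡ standard i j
      standard-under-hub₀ eq i zero = trans (hubs i) eq
      standard-under-hub₀ eq i (suc k) = short-at k (spokes-from eq i k) (rows i k) starts-at-k
        where
        starts-at-0 : pos i zero ≡ 0
        starts-at-0 = ℕ.n≤0⇒n≡0 (ℕ.+-cancelʳ-≤ L' (pos i zero) 0
                        (ℕ.s≤s⁻¹ (subst (_< L) (pos-end i) (short-bound (spokes-from eq i (fromℕ L'))))))
        starts-at-k : pos i k ≡ toℕ k
        starts-at-k = trans (pos-progression i k) (cong (_+ toℕ k) starts-at-0)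

      impossible-under-hub₁ : ρ zero zero ≡ hub₁ → ⊥
      impossible-under-hub₁ eq = misses (tabulate offset) hits
        where
        start≤L' : ∀ i → pos i zero ≤ L'
        start≤L' i = ℕ.+-cancelʳ-≤ L' (pos i zero) L'
                       (ℕ.s≤s⁻¹ (subst (_< M) (pos-end i) (long-bound (spokes-from eq i (fromℕ L')))))
        -- the column at which row i reaches position L'
        offset : Fin n → Fin L
        offset i = fromℕ< (s≤s (ℕ.m∸n≤m L' (pos i zero)))
        reaches-far : ∀ i → pos i (offset i) ≡ toℕ far
        reaches-far i = begin
          pos i (offset i)                 ≡⟨ pos-progression i (offset i) ⟩
          pos i zero + toℕ (offset i)      ≡⟨ cong (pos i zero +_) (toℕ-fromℕ< (s≤s (ℕ.m∸n≤m L' (pos i zero)))) ⟩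
          pos i zero + (L' ∸ pos i zero)   ≡⟨ ℕ.m+[n∸m]≡n (start≤L' i) ⟩
          L'                               ≡⟨ sym toℕ-far ⟩
          toℕ far                          ∎
          where open ≡-Reasoning
        hits : ∀ i → ρ i (suc (lookup (tabulate offset) i)) ≡ long i far
        hits i rewrite Vecₚ.lookup∘tabulate offset i =
          long-at far (spokes-from eq i (offset i)) (rows i (offset i)) (reaches-far i)

    shape-standard : ∀ i j → ρ i j ≡ standard i j
    shape-standard with spoke-source (spokes zero zero)
    ... | inj₁ eq = standard-under-hub₀ eq
    ... | inj₂ eq = ⊥-elim (impossible-under-hub₁ eq)

  x₀ : Fin m
  x₀ = var zero zero

  positions : Vec (Fin L) n → Vec (Fin m) n
  positions f = tabulate (λ i → var i (suc (lookup f i)))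

  lookup-positions : ∀ f i → lookup (positions f) i ≡ var i (suc (lookup f i))
  lookup-positions f i = Vecₚ.lookup∘tabulate (λ i → var i (suc (lookup f i))) i

  hubᶠ : Fin n → Formula τ m
  hubᶠ i = atEq (var i zero) x₀

  rowᶠ spokeᶠ : Fin n → Fin L → Formula τ m
  rowᶠ i k = atRel (rowᴿ i) (var i (suc k) ∷ [])
  spokeᶠ i k = atRel spokeᴿ (x₀ ∷ var i (suc k) ∷ [])

  stepᶠ : Fin n → Fin L' → Formula τ m
  stepᶠ i k = atRel succᴿ (var i (suc (inject₁ k)) ∷ var i (suc (suc k)) ∷ [])

  missᶠ : Vec (Fin L) n → Formula τ m
  missᶠ f = ¬f (atRel targetᴿ (positions f))

  ⋀[_] : ∀ {k} → (Fin k → Formula τ m) → Formula τ m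
  ⋀[ g ] = ⋀ x₀ (List.tabulate g)

  groups : List (Formula τ m)
  groups = ⋀[ hubᶠ ] ∷ ⋀[ (λ i → ⋀[ rowᶠ i ]) ] ∷ ⋀[ (λ i → ⋀[ stepᶠ i ]) ] ∷ ⋀[ (λ i → ⋀[ spokeᶠ i ]) ]
           ∷ ⋀ x₀ (List.map missᶠ (tuples L n)) ∷ []

  φ : Formula τ m
  φ = ⋀ x₀ groups

  dec-injective : ∀ {x y} → dec x ≡ dec y → x ≡ y
  dec-injective {x} {y} eq = trans (sym (enc-dec x)) (trans (cong enc eq) (enc-dec y))

  target-hit : ∀ (t : Vec (Fin N) m) (xs : Vec (Fin m) n) →
               isTuple target (Vec.map (lookup t) xs) ≡ true ⇔ (∀ i → dec (lookup t (lookup xs i)) ≡ long i far)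
  target-hit t xs = mk⇔ hit⇒far far⇒hit
    where
    open ≡-Reasoning
    entry : ∀ i → lookup (Vec.map (lookup t) xs) i ≡ lookup t (lookup xs i)
    entry i = Vecₚ.lookup-map i (lookup t) xs
    target-entry : ∀ i → lookup target i ≡ enc (long i far)
    target-entry i = Vecₚ.lookup∘tabulate (λ i → enc (long i far)) i
    hit⇒far : isTuple target (Vec.map (lookup t) xs) ≡ true → ∀ i → dec (lookup t (lookup xs i)) ≡ long i far
    hit⇒far hit i = begin
      dec (lookup t (lookup xs i))               ≡⟨ cong dec (sym (entry i)) ⟩
      dec (lookup (Vec.map (lookup t) xs) i)     ≡⟨ cong (λ v → dec (lookup v i)) (⌊⌋-witness (Vecₚ.≡-dec _≟_ _ target) hit) ⟩
      dec (lookup target i)                      ≡⟨ cong dec (target-entry i) ⟩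
      dec (enc (long i far))                     ≡⟨ dec-enc _ ⟩
      long i far                                 ∎
    far⇒hit : (∀ i → dec (lookup t (lookup xs i)) ≡ long i far) → isTuple target (Vec.map (lookup t) xs) ≡ true
    far⇒hit reads = ⌊⌋-true (Vecₚ.≡-dec _≟_ _ target) (vec-ext λ i → begin
      lookup (Vec.map (lookup t) xs) i           ≡⟨ entry i ⟩
      lookup t (lookup xs i)                     ≡⟨ sym (enc-dec _) ⟩
      enc (dec (lookup t (lookup xs i)))         ≡⟨ cong enc (reads i) ⟩
      enc (long i far)                           ≡⟨ sym (target-entry i) ⟩
      lookup target i                            ∎)

  φ-true : ∀ t → eval A φ t ≡ true ⇔ Shape (read t)
  φ-true t = mk⇔ shape-of holds
    where
    open Equivalence
    family : ∀ {k} (g : Fin k → Formula τ m) → eval A ⋀[ g ] t ≡ true ⇔ (∀ i → eval A (g i) t ≡ true)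
    family g = ⋀-tabulate A x₀ g
    family² : ∀ {k l} (g : Fin k → Fin l → Formula τ m) →
              eval A ⋀[ (λ i → ⋀[ g i ]) ] t ≡ true ⇔ (∀ i j → eval A (g i j) t ≡ true)
    family² g = mk⇔ (λ h i → to (family (g i)) (to (family (λ i → ⋀[ g i ])) h i))
                    (λ h → from (family (λ i → ⋀[ g i ])) (λ i → from (family (g i)) (h i)))
    miss⇔ : ∀ f → eval A (missᶠ f) t ≡ true ⇔ (¬ ∀ i → read t i (suc (lookup f i)) ≡ long i far)
    miss⇔ f = mk⇔ (λ h hit → not-true h (from (target-hit t (positions f)) (reads hit)))
                  (λ ¬hit → not-false (λ h → ¬hit (λ i → trans (cong (λ x → dec (lookup t x)) (sym (lookup-positions f i))) (to (target-hit t (positions f)) h i))))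
      where
      reads : (∀ i → read t i (suc (lookup f i)) ≡ long i far) → ∀ i → dec (lookup t (lookup (positions f) i)) ≡ long i far
      reads hit i = trans (cong (λ x → dec (lookup t x)) (lookup-positions f i)) (hit i)
      not-true : ∀ {b} → not b ≡ true → b ≢ true
      not-true {false} _ ()
      not-false : ∀ {b} → b ≢ true → not b ≡ true
      not-false {false} _ = refl
      not-false {true} b≢true = ⊥-elim (b≢true refl)
    misses⇔ : eval A (⋀ x₀ (List.map missᶠ (tuples L n))) t ≡ true ⇔ (∀ f → ¬ ∀ i → read t i (suc (lookup f i)) ≡ long i far)
    misses⇔ = mk⇔ (λ h f → to (miss⇔ f) (All.lookup (to (⋀-map A x₀ missᶠ (tuples L n)) h) (∈-tuples f)))
                  (λ h → from (⋀-map A x₀ missᶠ (tuples L n)) (All.tabulate λ {f} _ → from (miss⇔ f) (h f)))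
    shape-of : eval A φ t ≡ true → Shape (read t)
    shape-of h with to (⋀-true A x₀ groups) h
    ... | hubs All.∷ rows All.∷ steps All.∷ spokes All.∷ misses All.∷ All.[] = record
      { hubs = λ i → cong dec (⌊⌋-witness (lookup t (var i zero) ≟ lookup t x₀) (to (family hubᶠ) hubs i))
      ; rows = to (family² rowᶠ) rows
      ; steps = to (family² stepᶠ) steps
      ; spokes = to (family² spokeᶠ) spokes
      ; misses = to misses⇔ misses
      }
    holds : Shape (read t) → eval A φ t ≡ true
    holds shape = from (⋀-true A x₀ groups)
      (  from (family hubᶠ) (λ i → ⌊⌋-true (lookup t (var i zero) ≟ lookup t x₀) (dec-injective (hubs i)))
      All.∷ from (family² rowᶠ) rows All.∷ from (family² stepᶠ) steps All.∷ from (family² spokeᶠ) spokes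
      All.∷ from misses⇔ misses All.∷ All.[])
      where open Shape shape

  standard-shape : Shape (read p)
  standard-shape = record
    { hubs = λ i → trans (read-⟦⟧ standard i zero) (sym (read-⟦⟧ standard zero zero))
    ; rows = λ i k → subst (λ e → Row i e ≡ true) (sym (read-⟦⟧ standard i (suc k))) (⌊⌋-true (i ≟ i) refl)
    ; steps = λ i k → subst₂ (λ a b → Succ a b ≡ true) (sym (read-⟦⟧ standard i (suc (inject₁ k)))) (sym (read-⟦⟧ standard i (suc (suc k))))
                (cong₂ _∧_ (⌊⌋-true (i ≟ i) refl) (⌊⌋-true (suc (toℕ (inject₁ k)) ℕ.≟ suc (toℕ k)) (cong suc (toℕ-inject₁ k))))
    ; spokes = λ i k → subst₂ (λ a b → Spoke a b ≡ true) (sym (read-⟦⟧ standard zero zero)) (sym (read-⟦⟧ standard i (suc k))) refl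
    ; misses = λ f hit → short≢long (trans (sym (read-⟦⟧ standard zero (suc (lookup f zero)))) (hit zero))
    }
    where
    short≢long : ∀ {i k i' k'} → short i k ≢ long i' k'
    short≢long ()

  -- Definability: a tuple satisfying φ has the Shape, hence is p.
  φ-defines-T : Defines A φ T
  φ-defines-T t with Vecₚ.≡-dec _≟_ t p
  ... | yes refl = Equivalence.from (φ-true p) standard-shape
  ... | no t≢p with eval A φ t in holds
  ...   | false = refl
  ...   | true = ⊥-elim (t≢p (begin
          t                  ≡⟨ sym (⟦read⟧ t) ⟩
          ⟦ read t ⟧         ≡⟨ Vecₚ.tabulate-cong (λ x → cong enc (uncurry (shape-standard (Equivalence.to (φ-true t) holds)) (unvar x))) ⟩
          ⟦ standard ⟧       ∎))
    where open ≡-Reasoning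

  long-injective : ∀ {i i' k k'} → long i k ≡ long i' k' → i ≡ i' × k ≡ k'
  long-injective refl = refl , refl

  -- For f : Fin L ^ n, slide the short row i into the long row i
  -- so that column f i + 1 lands on far, and replace hub₀ by hub₁.  The result
  -- q is not in T, yet satisfies the same atoms as p except Target(positions f).
  module Fooling (f : Vec (Fin L) n) where

    gap : Fin n → ℕ
    gap i = L' ∸ toℕ (lookup f i)

    slide-bound : ∀ i (k : Fin L) → toℕ k + gap i < M
    slide-bound i k = s≤s (ℕ.+-mono-≤ (ℕ.s≤s⁻¹ (toℕ<n k)) (ℕ.m∸n≤m L' (toℕ (lookup f i))))

    slide : Fin n → Fin L → Fin M
    slide i k = fromℕ< (slide-bound i k)

    toℕ-slide : ∀ i k → toℕ (slide i k) ≡ toℕ k + gap i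
    toℕ-slide i k = toℕ-fromℕ< (slide-bound i k)

    swap : Elem → Elem
    swap hub₀ = hub₁
    swap (short i k) = long i (slide i k)
    swap e = e

    q : Vec (Fin N) m
    q = ⟦ (λ i j → swap (standard i j)) ⟧

    slide-injective : ∀ {i k k'} → slide i k ≡ slide i k' → k ≡ k'
    slide-injective {i} {k} {k'} eq =
      toℕ-injective (ℕ.+-cancelʳ-≡ (gap i) (toℕ k) (toℕ k') (trans (sym (toℕ-slide i k)) (trans (cong toℕ eq) (toℕ-slide i k'))))

    swap-injective : ∀ X Y → swap (uncurry standard X) ≡ swap (uncurry standard Y) → uncurry standard X ≡ uncurry standard Y
    swap-injective (i , zero) (i' , zero) _ = refl
    swap-injective (i , suc k) (i' , suc k') eq with long-injective eq
    ... | refl , slides = cong (short i) (slide-injective slides)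

    swap-Succ : ∀ X Y → Succ (uncurry standard X) (uncurry standard Y) ≡ Succ (swap (uncurry standard X)) (swap (uncurry standard Y))
    swap-Succ (i , zero) Y = refl
    swap-Succ (i , suc k) (i' , zero) = refl
    swap-Succ (i , suc k) (i' , suc k') with i ≟ i'
    ... | no _ = refl
    ... | yes refl = ⌊⌋-⇔ (suc (toℕ k) ℕ.≟ toℕ k') (suc (toℕ (slide i k)) ℕ.≟ toℕ (slide i k'))
          (λ e → trans (cong suc (toℕ-slide i k)) (trans (cong (_+ gap i) e) (sym (toℕ-slide i k'))))
          (λ e → ℕ.+-cancelʳ-≡ (gap i) (suc (toℕ k)) (toℕ k') (trans (cong suc (sym (toℕ-slide i k))) (trans e (toℕ-slide i k'))))

    swap-Spoke : ∀ X Y → Spoke (uncurry standard X) (uncurry standard Y) ≡ Spoke (swap (uncurry standard X)) (swap (uncurry standard Y))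
    swap-Spoke (i , zero) (i' , zero) = refl
    swap-Spoke (i , zero) (i' , suc k) = refl
    swap-Spoke (i , suc k) Y = refl

    swap-Row : ∀ r X → Row r (uncurry standard X) ≡ Row r (swap (uncurry standard X))
    swap-Row r (i , zero) = refl
    swap-Row r (i , suc k) = refl

    swap-far : ∀ X i → swap (uncurry standard X) ≡ long i far → X ≡ (i , suc (lookup f i))
    swap-far (i' , suc k) i eq with long-injective eq
    ... | refl , slides = cong (λ k → i , suc k) (toℕ-injective (ℕ.+-cancelʳ-≡ (gap i) (toℕ k) (toℕ (lookup f i)) (begin
      toℕ k + gap i                      ≡⟨ sym (toℕ-slide i k) ⟩
      toℕ (slide i k)                    ≡⟨ cong toℕ slides ⟩
      toℕ far                            ≡⟨ toℕ-far ⟩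
      L'                                 ≡⟨ sym (ℕ.m+[n∸m]≡n (ℕ.s≤s⁻¹ (toℕ<n (lookup f i)))) ⟩
      toℕ (lookup f i) + gap i           ∎)))
      where open ≡-Reasoning

    private
      value-p : ∀ x → dec (lookup p x) ≡ uncurry standard (unvar x)
      value-p = dec-⟦⟧ standard
      value-q : ∀ x → dec (lookup q x) ≡ swap (uncurry standard (unvar x))
      value-q = dec-⟦⟧ (λ i j → swap (standard i j))

    p-misses : ∀ xs → isTuple target (Vec.map (lookup p) xs) ≡ false
    p-misses xs with isTuple target (Vec.map (lookup p) xs) in hit
    ... | false = refl
    ... | true = ⊥-elim (never-long (unvar (lookup xs zero)) (trans (sym (value-p (lookup xs zero))) (Equivalence.to (target-hit p xs) hit zero)))
      where
      never-long : ∀ X → uncurry standard X ≢ long zero far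
      never-long (_ , zero) ()
      never-long (_ , suc _) ()

    only-target-separates : ∀ α → Separates A α p q → α ≡ targetᴿ ⟨ positions f ⟩
    only-target-separates (x ≐ y) sep = ⊥-elim (sep (⌊⌋-⇔ (lookup p x ≟ lookup p y) (lookup q x ≟ lookup q y)
      (λ e → dec-injective (trans (value-q x) (trans (cong swap (same-p e)) (sym (value-q y)))))
      (λ e → dec-injective (trans (value-p x) (trans (swap-injective (unvar x) (unvar y) (same-q e)) (sym (value-p y)))))))
      where
      same-p : lookup p x ≡ lookup p y → uncurry standard (unvar x) ≡ uncurry standard (unvar y)
      same-p e = trans (sym (value-p x)) (trans (cong dec e) (value-p y))
      same-q : lookup q x ≡ lookup q y → swap (uncurry standard (unvar x)) ≡ swap (uncurry standard (unvar y))
      same-q e = trans (sym (value-q x)) (trans (cong dec e) (value-q y))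
    only-target-separates (zero ⟨ x ∷ y ∷ [] ⟩) sep =
      ⊥-elim (sep (trans (cong₂ Succ (value-p x) (value-p y)) (trans (swap-Succ (unvar x) (unvar y)) (sym (cong₂ Succ (value-q x) (value-q y))))))
    only-target-separates (suc zero ⟨ x ∷ y ∷ [] ⟩) sep =
      ⊥-elim (sep (trans (cong₂ Spoke (value-p x) (value-p y)) (trans (swap-Spoke (unvar x) (unvar y)) (sym (cong₂ Spoke (value-q x) (value-q y))))))
    only-target-separates (suc (suc (suc r)) ⟨ x ∷ [] ⟩) sep =
      ⊥-elim (sep (trans (cong (Row r) (value-p x)) (trans (swap-Row r (unvar x)) (sym (cong (Row r) (value-q x))))))
    only-target-separates (suc (suc zero) ⟨ xs ⟩) sep = cong (targetᴿ ⟨_⟩) (vec-ext at-positions)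
      where
      q-hits : isTuple target (Vec.map (lookup q) xs) ≡ true
      q-hits = trans (¬-not (λ e → sep (sym e))) (cong not (p-misses xs))
      at-positions : ∀ i → lookup xs i ≡ lookup (positions f) i
      at-positions i = begin
        lookup xs i                                ≡⟨ sym (var-unvar (lookup xs i)) ⟩
        uncurry var (unvar (lookup xs i))          ≡⟨ cong (uncurry var) (swap-far (unvar (lookup xs i)) i (trans (sym (value-q (lookup xs i))) (Equivalence.to (target-hit q xs) q-hits i))) ⟩
        var i (suc (lookup f i))                   ≡⟨ sym (lookup-positions f i) ⟩
        lookup (positions f) i                     ∎
        where open ≡-Reasoning

    q∉T : T q ≡ false
    q∉T = ⌊⌋-false (Vecₚ.≡-dec _≟_ q p) (λ e → hub₁≢hub₀ (begin
      hub₁                         ≡⟨ sym (read-⟦⟧ (λ i j → swap (standard i j)) zero zero) ⟩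
      read q zero zero             ≡⟨ cong (λ t → read t zero zero) e ⟩
      read p zero zero             ≡⟨ read-⟦⟧ standard zero zero ⟩
      hub₀                         ∎))
      where
      open ≡-Reasoning
      hub₁≢hub₀ : hub₁ ≢ hub₀
      hub₁≢hub₀ ()

  positions-injective : ∀ {f g} → positions f ≡ positions g → f ≡ g
  positions-injective {f} {g} eq = vec-ext λ i → suc-injective (cong proj₂ (begin
    (i , suc (lookup f i))                 ≡⟨ sym (unvar-var i _) ⟩
    unvar (var i (suc (lookup f i)))       ≡⟨ cong unvar (sym (lookup-positions f i)) ⟩
    unvar (lookup (positions f) i)         ≡⟨ cong (λ v → unvar (lookup v i)) eq ⟩
    unvar (lookup (positions g) i)         ≡⟨ cong unvar (lookup-positions g i) ⟩
    unvar (var i (suc (lookup g i)))       ≡⟨ unvar-var i _ ⟩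
    (i , suc (lookup g i))                 ∎))
    where open ≡-Reasoning

  p∈T : T p ≡ true
  p∈T = ⌊⌋-true (Vecₚ.≡-dec _≟_ p p) refl

  definitions-are-long : ∀ ψ → Defines A ψ T → L ^ n ≤ literals ψ
  definitions-are-long ψ ψ-defines = subst (_≤ literals ψ) (length-tuples L n)
    (fooling-pairs A (tuples L n) (tuples-unique L n) (λ f → targetᴿ ⟨ positions f ⟩)
      (λ eq → positions-injective (⟨⟩-injective eq)) (λ _ → p) Fooling.q T
      (λ f e → true≢false (trans (sym p∈T) (trans e (Fooling.q∉T f))))
      Fooling.only-target-separates ψ ψ-defines)
    where
    true≢false : true ≢ false
    true≢false ()

  predecessor : Elem → Elem
  predecessor (short i k) = short i (Fin.pred k)
  predecessor (long i k) = long i (Fin.pred k)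
  predecessor _ = hub₀

  succ-predecessor : ∀ a b → Succ a b ≡ true → a ≡ predecessor b
  succ-predecessor (short i k) (short i' k') s = uncurry (cong₂ short) (step-back s)
  succ-predecessor (long i k) (long i' k') s = uncurry (cong₂ long) (step-back s)

  -- Succ is the graph of predecessor (read backwards), so has at most N tuples.
  card-Succ : card (interpret succᴿ) ≤ N
  card-Succ = card≤image (interpret succᴿ) (λ y → enc (predecessor (dec y)) ∷ y ∷ []) covered
    where
    covered : ∀ t → interpret succᴿ t ≡ true → ∃ λ y → enc (predecessor (dec y)) ∷ y ∷ [] ≡ t
    covered (a ∷ b ∷ []) s = b , cong (_∷ b ∷ []) (trans (cong enc (sym (succ-predecessor (dec a) (dec b) s))) (enc-dec a))

  hub : Fin 2 → Elem
  hub zero = hub₀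
  hub (suc zero) = hub₁

  -- a Spoke tuple is fixed by the hub it starts from and its second entry
  spoke-tuple : Fin (2 * N) → Vec (Fin N) 2
  spoke-tuple x = enc (hub (proj₁ (remQuot {2} N x))) ∷ proj₂ (remQuot {2} N x) ∷ []

  card-Spoke : card (interpret spokeᴿ) ≤ 2 * N
  card-Spoke = card≤image (interpret spokeᴿ) spoke-tuple covered
    where
    from-hub : ∀ h a b → dec a ≡ hub h → ∃ λ x → spoke-tuple x ≡ a ∷ b ∷ []
    from-hub h a b e = combine h b , (begin
      spoke-tuple (combine h b)   ≡⟨ cong (λ hy → enc (hub (proj₁ hy)) ∷ proj₂ hy ∷ []) (remQuot-combine {2} {N} h b) ⟩
      enc (hub h) ∷ b ∷ []        ≡⟨ cong (λ e → enc e ∷ b ∷ []) (sym e) ⟩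
      enc (dec a) ∷ b ∷ []        ≡⟨ cong (_∷ b ∷ []) (enc-dec a) ⟩
      a ∷ b ∷ []                  ∎)
      where open ≡-Reasoning
    covered : ∀ t → interpret spokeᴿ t ≡ true → ∃ λ x → spoke-tuple x ≡ t
    covered (a ∷ b ∷ []) s with spoke-source {dec a} {dec b} s
    ... | inj₁ e = from-hub zero a b e
    ... | inj₂ e = from-hub (suc zero) a b e

  row-cell : ∀ i e → Row i e ≡ true → ∃ λ j → cell i j ≡ e
  row-cell i (short i' k) r rewrite ⌊⌋-witness (i ≟ i') r = k ↑ˡ M , cong [ short i' , long i' ]′ (splitAt-↑ˡ L k M)
  row-cell i (long i' k) r rewrite ⌊⌋-witness (i ≟ i') r = L ↑ʳ k , cong [ short i' , long i' ]′ (splitAt-↑ʳ L M k)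

  card-Row : ∀ i → card (interpret (rowᴿ i)) ≤ W
  card-Row i = card≤image (interpret (rowᴿ i)) (λ j → enc (cell i j) ∷ []) covered
    where
    covered : ∀ t → interpret (rowᴿ i) t ≡ true → ∃ λ j → enc (cell i j) ∷ [] ≡ t
    covered (a ∷ []) r with row-cell i (dec a) r
    ... | j , e = j , cong (_∷ []) (trans (cong enc e) (enc-dec a))

  -- Polynomial identities behind the size bound, stated for x = L', so that
  -- n = 2 + x, W = L + M = 3x + 2 and N = 2 + n W.
  universe-cubic : ∀ x → let n = 2 + x; N = 2 + n * ((1 + x) + ((1 + x) + x)) in
                   N + (x * x * x + 3 * x * x + 4 * x + 2) ≡ n * (n * n)
  universe-cubic = solve-∀

  symbols-fit : ∀ x → let n = 2 + x; N = 2 + n * ((1 + x) + ((1 + x) + x)) in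
                (3 + n) + (3 * x * x + 7 * x + 1) ≡ N
  symbols-fit = solve-∀

  size-quadratic : ∀ x → let n = 2 + x; W = (1 + x) + ((1 + x) + x); N = 2 + n * W in
    ((3 + n) + (2 + (2 + (n + n * 1)))) + (N + (2 * N + (2 * (2 * N) + (n * 1 + n * W)))) + n * (n * 1) + (28 * x + 35)
    ≡ 25 * (n * n)
  size-quadratic = solve-∀

  arity-sum : sum (List.map arity (List.allFin (3 + n))) ≤ 2 + (2 + (n + n * 1))
  arity-sum = ℕ.+-monoʳ-≤ 4 (ℕ.+-monoʳ-≤ n (sum-tabulate-≤ n rowᴿ arity 1 (λ _ → ℕ.≤-refl)))

  tuple-sum : sum (List.map (λ R → arity R * card (interpret R)) (List.allFin (3 + n)))
              ≤ 2 * N + (2 * (2 * N) + (n * 1 + n * W))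
  tuple-sum = ℕ.+-mono-≤ (ℕ.*-monoʳ-≤ 2 card-Succ) (ℕ.+-mono-≤ (ℕ.*-monoʳ-≤ 2 card-Spoke)
                (ℕ.+-mono-≤ (ℕ.*-monoʳ-≤ n (card-isTuple target))
                  (sum-tabulate-≤ n rowᴿ (λ R → arity R * card (interpret R)) W (λ i → ℕ.≤-trans (ℕ.≤-reflexive (ℕ.*-identityˡ _)) (card-Row i)))))

  -- size(A, T) = O(n³ log n): the structure has O(n²) elements and tuples, and log N = O(log n).
  size-bound : sizeStrRel A T ≤ 225 * (n ^ 3) * lg n
  size-bound = begin
    (sizeStr A + m * card T) * lg N
      ≤⟨ ℕ.*-monoˡ-≤ (lg N) (ℕ.+-mono-≤ (ℕ.+-mono-≤ (ℕ.*-mono-≤ (ℕ.+-monoʳ-≤ (3 + n) arity-sum) (lg-mono symbols≤N))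
                                                     (ℕ.*-monoˡ-≤ (lg N) (ℕ.+-monoʳ-≤ N tuple-sum)))
                                         (ℕ.*-monoʳ-≤ m (ℕ.≤-trans (card-isTuple p) (1≤lg N)))) ⟩
    (V * lg N + S * lg N + m * lg N) * lg N
      ≡⟨ cong (_* lg N) (distrib V S m (lg N)) ⟩
    ((V + S + m) * lg N) * lg N
      ≤⟨ ℕ.*-mono-≤ (ℕ.*-mono-≤ Q≤25n² lgN≤3lgn) (ℕ.≤-trans lgN≤3lgn (ℕ.*-monoʳ-≤ 3 (lg≤id {n} (s≤s z≤n)))) ⟩
    (25 * (n * n) * (3 * lg n)) * (3 * n)
      ≡⟨ regroup n (lg n) ⟩
    225 * (n ^ 3) * lg n ∎
    where
    open ℕ.≤-Reasoning
    V S : ℕ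
    V = (3 + n) + (2 + (2 + (n + n * 1)))
    S = N + (2 * N + (2 * (2 * N) + (n * 1 + n * W)))
    symbols≤N : 3 + n ≤ N
    symbols≤N = ℕ.m+n≤o⇒m≤o (3 + n) (ℕ.≤-reflexive (symbols-fit L'))
    Q≤25n² : V + S + m ≤ 25 * (n * n)
    Q≤25n² = ℕ.m+n≤o⇒m≤o (V + S + m) (ℕ.≤-reflexive (size-quadratic L'))
    lgN≤3lgn : lg N ≤ 3 * lg n
    lgN≤3lgn = ℕ.≤-trans (lg-mono (ℕ.m+n≤o⇒m≤o N (ℕ.≤-reflexive (universe-cubic L')))) (lg-cube n)
    distrib : ∀ a b c l → a * l + b * l + c * l ≡ (a + b + c) * l
    distrib = solve-∀
    regroup : ∀ n l → (25 * (n * n) * (3 * l)) * (3 * n) ≡ 225 * (n * (n * (n * 1))) * l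
    regroup = solve-∀

theorem5p1 : ∃ λ (C : ℕ) → ∀ (n : ℕ) → 3 ≤ n →
    Σ Vocabulary λ τ → Σ (Structure τ) λ A →
    Σ (Vec (Fin (univ A)) (n ^ 2) → Bool) λ T →
      (sizeStrRel A T ≤ C * (n ^ 3) * lg n)
      × OpenDefinable A T
      × (∀ (φ : Formula τ (n ^ 2)) → Defines A φ T → (n ∸ 1) ^ n ≤ literals φ)
theorem5p1 = 225 , witness
  where
  witness : ∀ (n : ℕ) → 3 ≤ n →
    Σ Vocabulary λ τ → Σ (Structure τ) λ A →
    Σ (Vec (Fin (univ A)) (n ^ 2) → Bool) λ T →
      (sizeStrRel A T ≤ 225 * (n ^ 3) * lg n)
      × OpenDefinable A T
      × (∀ (φ : Formula τ (n ^ 2)) → Defines A φ T → (n ∸ 1) ^ n ≤ literals φ)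
  witness (suc (suc x)) _ = τ , A , T , size-bound , (φ , φ-defines-T) , definitions-are-long
    where open Construction x
  witness (suc zero) (s≤s ())
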